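{- Let $G=(V,E,w)$ be a weighted undirected graph with $n$ vertices and conductance $\Phi_G>0$, and let $\mathcal{T}^*$ be an optimal HC tree of $G$ with dense branch $(A_0,\dots,A_k)$, $k\ge 0$. If $|A_k|\ge (n-1)/2$, then every HC tree $\mathcal{T}$ of $G$ satisfies $\mathrm{cost}_G(\mathcal{T})\le 8\,\mathrm{cost}_G(\mathcal{T}^*)/\Phi_G$. In particular, $\mathrm{cost}_G(\mathcal{T}_{\deg}(G))\le 8\,\mathsf{OPT}_G/\Phi_G$.
   Context: $d_u=\sum_v w_{uv}$, $\mathrm{vol}(S)=\sum_{u\in S}d_u$, $\mathrm{vol}(G)=\mathrm{vol}(V)$, $\Phi_G=\min\{w(S,V\setminus S)/\mathrm{vol}(S): \emptyset\neq S\subset V,\ \mathrm{vol}(S)\le\mathrm{vol}(V)/2\}$ where $w(S,T)$ is the total weight of edges between $S$ and $T$. An HC tree is a rooted binary tree with leaves in bijection with $V$; nodes are identified with the vertex sets of the leaves below them, $|N|$ being the size. $\mathrm{cost}_G(\mathcal{T})=\sum_{e=\{u,v\}\in E} w_e\cdot|\mathsf{leaves}(\mathcal{T}[u\vee v])|$ ($u\vee v$ the lowest common ancestor); $\mathsf{OPT}_G$ is the minimum cost. The dense branch $(A_0,\dots,A_k)$ of a tree: $A_0$ is the root, $A_{i+1}$ is the child of $A_i$ of higher volume, and $A_k$ has $\mathrm{vol}(A_k)>\mathrm{vol}(G)/2$ while both its children have volume at most $\mathrm{vol}(G)/2$. $\mathcal{T}_{\deg}(G)$ is defined recursively: order vertices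 by non-increasing degree in $G$; a single vertex gives a leaf; otherwise with $r=2^{\lfloor\log_2(|V'|-1)\rfloor}$, the root has children $\mathcal{T}_{\deg}$ on the $r$ highest-degree vertices $A$ and $\mathcal{T}_{\deg}$ on $V'\setminus A$.
   Formalization: The edge weights of G are nonnegative rationals rather than nonnegative reals, so the conductance Φ_G is rational as well. -}

module Defs where

open import Data.Bool using (Bool; true; false; if_then_else_; _∧_; _∨_; not)
open import Data.Nat as ℕ using (ℕ; zero; suc; _^_)
open import Data.Nat.Logarithm using (⌊log₂_⌋)
open import Data.Fin as Fin using (Fin; toℕ)
open import Data.List using (List; []; _∷_; _++_; length; take; drop; allFin; map)
open import Data.List.Relation.Binary.Permutation.Propositional using (_↭_)
open import Data.Maybe using (Maybe; just; nothing)
open import Data.Product using (Σ; _×_; _,_; ∃-syntax)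
open import Data.Integer using (+_)
open import Data.Rational using (ℚ; 0ℚ; 1ℚ; ½; _+_; _*_; _≤_; _<_; _≤ᵇ_; _/_)
open import Relation.Binary.PropositionalEquality using (_≡_)
open import Relation.Nullary.Decidable using (⌊_⌋)

-- Weighted undirected graph on vertex set Fin n: symmetric, nonnegative
-- rational weights, no self loops.  Edges = pairs {u,v} with w u v > 0.
record WGraph (n : ℕ) : Set where
  field
    w       : Fin n → Fin n → ℚ
    w-sym   : ∀ u v → w u v ≡ w v u
    w-nonneg : ∀ u v → 0ℚ ≤ w u v
    w-loop  : ∀ u → w u u ≡ 0ℚ
open WGraph public

sumFin : ∀ {n} → (Fin n → ℚ) → ℚ
sumFin {zero}  f = 0ℚ
sumFin {suc n} f = f Fin.zero + sumFin (λ i → f (Fin.suc i))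

ℕ→ℚ : ℕ → ℚ
ℕ→ℚ k = + k / 1

Subset : ℕ → Set
Subset n = Fin n → Bool

ind : Bool → ℚ
ind true  = 1ℚ
ind false = 0ℚ

deg : ∀ {n} → WGraph n → Fin n → ℚ
deg G u = sumFin (λ v → w G u v)

vol : ∀ {n} → WGraph n → Subset n → ℚ
vol G S = sumFin (λ u → ind (S u) * deg G u)

volG : ∀ {n} → WGraph n → ℚ
volG G = vol G (λ _ → true)

cut : ∀ {n} → WGraph n → Subset n → ℚ
cut G S = sumFin (λ u → sumFin (λ v → ind (S u ∧ not (S v)) * w G u v))

Admissible : ∀ {n} → WGraph n → Subset n → Set
Admissible G S = (∃[ v ] S v ≡ true) × (vol G S ≤ ½ * volG G)

-- Ratios are cross-multiplied (valid since vol S > 0).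
IsConductance : ∀ {n} → WGraph n → ℚ → Set
IsConductance G φ =
  (∀ S → Admissible G S → 0ℚ < vol G S) ×
  (∀ S → Admissible G S → φ * vol G S ≤ cut G S) ×
  (∃[ S ] (Admissible G S × (φ * vol G S ≡ cut G S)))

data Tree (n : ℕ) : Set where
  leaf : Fin n → Tree n
  node : Tree n → Tree n → Tree n

leaves : ∀ {n} → Tree n → List (Fin n)
leaves (leaf v)   = v ∷ []
leaves (node l r) = leaves l ++ leaves r

IsHC : ∀ {n} → Tree n → Set
IsHC {n} T = leaves T ↭ allFin n

elem : ∀ {n} → Fin n → List (Fin n) → Bool
elem u []       = false
elem u (x ∷ xs) = ⌊ u Fin.≟ x ⌋ ∨ elem u xs

nodeSet : ∀ {n} → Tree n → Subset n
nodeSet T u = elem u (leaves T)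

lcaSize : ∀ {n} → Tree n → Fin n → Fin n → ℕ
lcaSize (leaf x) u v = 1
lcaSize (node l r) u v =
  if elem u (leaves l) ∧ elem v (leaves l) then lcaSize l u v
  else if elem u (leaves r) ∧ elem v (leaves r) then lcaSize r u v
  else length (leaves (node l r))

-- cost_G(T) = Σ_{ {u,v} ∈ E } w_uv |leaves(T[u ∨ v])|, each unordered pair once (u < v)
cost : ∀ {n} → WGraph n → Tree n → ℚ
cost G T = sumFin (λ u → sumFin (λ v →
  ind (⌊ toℕ u ℕ.<? toℕ v ⌋) * (w G u v * ℕ→ℚ (lcaSize T u v))))

IsOptimal : ∀ {n} → WGraph n → Tree n → Set
IsOptimal G T = IsHC T × (∀ T′ → IsHC T′ → cost G T ≤ cost G T′)

-- last node A_k of the dense branch (A_0,…,A_k): start at the root, move to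
-- the child of higher volume (ties: left; irrelevant) until both
-- children have volume ≤ vol(G)/2.
denseEnd : ∀ {n} → WGraph n → Tree n → Tree n
denseEnd G (leaf v) = leaf v
denseEnd G (node l r) =
  if (vl ≤ᵇ h) ∧ (vr ≤ᵇ h) then node l r
  else (if vr ≤ᵇ vl then denseEnd G l else denseEnd G r)
  where
    h  = ½ * volG G
    vl = vol G (nodeSet l)
    vr = vol G (nodeSet r)

-- insertion sort by non-increasing degree (ties: smaller index first)
insertDeg : ∀ {n} → WGraph n → Fin n → List (Fin n) → List (Fin n)
insertDeg G v [] = v ∷ []
insertDeg G v (x ∷ xs) =
  if deg G x ≤ᵇ deg G v then v ∷ x ∷ xs else x ∷ insertDeg G v xs

sortDeg : ∀ {n} → WGraph n → List (Fin n) → List (Fin n)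
sortDeg G []       = []
sortDeg G (x ∷ xs) = insertDeg G x (sortDeg G xs)

-- recursive construction on a degree-sorted list, with fuel (fuel = length
-- suffices since both parts are strictly shorter)
buildDeg : ∀ {n} → ℕ → List (Fin n) → Maybe (Tree n)
buildDeg f [] = nothing
buildDeg f (v ∷ []) = just (leaf v)
buildDeg zero (v ∷ u ∷ xs) = nothing
buildDeg (suc f) xs@(v ∷ u ∷ ys) with buildDeg f (take r xs) | buildDeg f (drop r xs)
  where r = 2 ^ ⌊log₂ (length xs ℕ.∸ 1) ⌋
... | just a | just b = just (node a b)
... | _      | _      = nothing

-- T_deg(G); `nothing` only when n = 0
Tdeg : ∀ {n} → WGraph n → Maybe (Tree n)
Tdeg {n} G = buildDeg n (sortDeg G (allFin n))

{-# OPTIONS --safe #-}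
module Submission where

-- Let A = B ∪ C be the last node of the dense branch of T*: vol(A) > vol(G)/2, while its
-- children B and C have volume at most vol(G)/2, so conductance gives
-- Φ vol(A) ≤ w(B, V∖B) + w(C, V∖C).  An edge leaving B or C has its lowest common ancestor
-- in T* at or above A, hence |A| (w(B, V∖B) + w(C, V∖C)) ≤ 2 cost(T*).  Any tree T costs at
-- most n w(E) = n vol(G)/2 < n vol(A), and n ≤ 1 + 2|A| ≤ 4|A|, so
-- cost(T) Φ ≤ 4 |A| Φ vol(A) ≤ 8 cost(T*).

module CostBound where

  open import Defs
  open import Algebra.Bundles using (CommutativeMonoid; CommutativeRing)
  open import Data.Bool using (true; false; if_then_else_; _∧_; _∨_; not)
  import Data.Bool as Bool
  open import Data.Bool.Properties using (∧-comm; ∨-assoc; ∨-zeroʳ)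
  open import Data.Empty using (⊥-elim)
  open import Data.Unit using (⊤; tt)
  open import Data.Fin using (Fin; zero; suc; toℕ; _≟_)
  open import Data.Fin.Properties using (toℕ-injective)
  import Data.Integer as ℤ
  import Data.Integer.Properties as ℤ
  open import Data.List using (List; []; _∷_; _++_; length; allFin; take; drop)
  open import Data.List.Properties using (length-++; length-tabulate; take++drop≡id)
  open import Data.List.Membership.Propositional using (_∈_; _∉_)
  open import Data.List.Membership.Propositional.Properties using (∈-allFin)
  open import Data.List.Relation.Binary.Permutation.Propositional using (↭-sym; ↭⇒↭ₛ)
  open import Data.List.Relation.Binary.Permutation.Propositional.Properties using (↭-length; ∈-resp-↭)
  import Data.List.Relation.Binary.Permutation.Setoid.Properties as Permₛ
  import Data.List.Relation.Unary.All as All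
  import Data.List.Relation.Unary.All.Properties as All
  open import Data.List.Relation.Unary.Any using (here; there)
  open import Data.List.Relation.Unary.Unique.Propositional using (Unique; []; _∷_)
  open import Data.List.Relation.Unary.Unique.Propositional.Properties using (allFin⁺)
  open import Data.Maybe using (just)
  open import Data.Nat as ℕ using (ℕ; zero; suc)
  import Data.Nat.Properties as ℕ
  open import Data.Nat.Coprimality as Coprime using (1-coprimeTo)
  open import Data.Nat.Logarithm using (⌊log₂_⌋)
  open import Data.Product using (_×_; _,_; proj₁; proj₂; ∃-syntax)
  open import Data.Sum using (_⊎_; inj₁; inj₂)
  open import Data.Rational
    using (ℚ; mkℚ; 0ℚ; ½; _+_; _*_; _≤_; _<_; _≤ᵇ_; *≤*; toℚᵘ; nonNegative)
  open import Data.Rational.Properties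
    using ( ≤-refl; ≤-reflexive; ≤-trans; <-trans; <-irrefl; <-≤-trans; <⇒≤; ≮⇒≥; ≰⇒>; ≤ᵇ⇒≤; ≤⇒≤ᵇ
          ; +-identityˡ; +-identityʳ; *-identityˡ; *-zeroˡ; *-comm; *-distribˡ-+; *-distribʳ-+
          ; +-mono-≤; +-mono-<; +-monoʳ-<; *-monoˡ-≤-nonNeg; *-monoʳ-≤-nonNeg
          ; normalize-coprime; toℚᵘ-injective; toℚᵘ-homo-*; +-*-commutativeRing; *-1-commutativeMonoid
          ; module ≤-Reasoning )
  import Data.Rational.Unnormalised as ℚᵘ
  import Data.Rational.Unnormalised.Properties as ℚᵘ
  open import Data.Rational.Solver using (module +-*-Solver)
  open import Function using (_∘_)
  open import Relation.Nullary using (¬_; yes; no)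
  open import Relation.Nullary.Decidable using (⌊_⌋)
  open import Relation.Binary.PropositionalEquality
    using (_≡_; refl; sym; trans; cong; cong₂; subst; module ≡-Reasoning)
  import Relation.Binary.PropositionalEquality as ≡
  open import Algebra.Properties.Semiring.Sum (CommutativeRing.semiring +-*-commutativeRing)
    using (sum; ∑-distrib-+; ∑-comm; *-distribˡ-sum)
  open import Algebra.Properties.CommutativeSemigroup
    (CommutativeMonoid.commutativeSemigroup *-1-commutativeMonoid) using (x∙yz≈y∙xz)

  private variable
    n : ℕ

  -- Finite sums

  sumFin≡sum : (f : Fin n → ℚ) → sumFin f ≡ sum f
  sumFin≡sum {zero}  f = refl
  sumFin≡sum {suc n} f = cong (f zero +_) (sumFin≡sum (f ∘ suc))

  sumFin-cong : {f g : Fin n → ℚ} → (∀ i → f i ≡ g i) → sumFin f ≡ sumFin g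
  sumFin-cong {zero}  e = refl
  sumFin-cong {suc n} e = cong₂ _+_ (e zero) (sumFin-cong (e ∘ suc))

  sumFin-+ : (f g : Fin n → ℚ) → sumFin (λ i → f i + g i) ≡ sumFin f + sumFin g
  sumFin-+ f g = begin
    sumFin (λ i → f i + g i)  ≡⟨ sumFin≡sum (λ i → f i + g i) ⟩
    sum (λ i → f i + g i)     ≡⟨ ∑-distrib-+ f g ⟩
    sum f + sum g             ≡⟨ sym (cong₂ _+_ (sumFin≡sum f) (sumFin≡sum g)) ⟩
    sumFin f + sumFin g       ∎
    where open ≡-Reasoning

  sumFin-*ˡ : (c : ℚ) (f : Fin n → ℚ) → c * sumFin f ≡ sumFin (λ i → c * f i)
  sumFin-*ˡ c f = begin
    c * sumFin f              ≡⟨ cong (c *_) (sumFin≡sum f) ⟩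
    c * sum f                 ≡⟨ *-distribˡ-sum c f ⟩
    sum (λ i → c * f i)       ≡⟨ sym (sumFin≡sum (λ i → c * f i)) ⟩
    sumFin (λ i → c * f i)    ∎
    where open ≡-Reasoning

  sumFin-comm : ∀ {m} (f : Fin n → Fin m → ℚ) →
    sumFin (λ i → sumFin (f i)) ≡ sumFin (λ j → sumFin (λ i → f i j))
  sumFin-comm f = begin
    sumFin (λ i → sumFin (f i))            ≡⟨ sumFin-cong (λ i → sumFin≡sum (f i)) ⟩
    sumFin (λ i → sum (f i))               ≡⟨ sumFin≡sum (λ i → sum (f i)) ⟩
    sum (λ i → sum (f i))                  ≡⟨ ∑-comm f ⟩
    sum (λ j → sum (λ i → f i j))          ≡⟨ sym (sumFin≡sum (λ j → sum (λ i → f i j))) ⟩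
    sumFin (λ j → sum (λ i → f i j))       ≡⟨ sym (sumFin-cong (λ j → sumFin≡sum (λ i → f i j))) ⟩
    sumFin (λ j → sumFin (λ i → f i j))    ∎
    where open ≡-Reasoning

  sumFin-mono-≤ : {f g : Fin n → ℚ} → (∀ i → f i ≤ g i) → sumFin f ≤ sumFin g
  sumFin-mono-≤ {zero}  e = ≤-refl
  sumFin-mono-≤ {suc n} e = +-mono-≤ (e zero) (sumFin-mono-≤ (e ∘ suc))

  sumFin-nonNeg : {f : Fin n → ℚ} → (∀ i → 0ℚ ≤ f i) → 0ℚ ≤ sumFin f
  sumFin-nonNeg {zero}  e = ≤-refl
  sumFin-nonNeg {suc n} e = +-mono-≤ (e zero) (sumFin-nonNeg (e ∘ suc))

  doubleSum : (Fin n → Fin n → ℚ) → ℚ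
  doubleSum f = sumFin (λ u → sumFin (f u))

  ordered : Fin n → Fin n → ℚ
  ordered u v = ind ⌊ toℕ u ℕ.<? toℕ v ⌋

  pairSum : (Fin n → Fin n → ℚ) → ℚ
  pairSum f = doubleSum (λ u v → ordered u v * f u v)

  ordered-complement : ∀ (u v : Fin n) x → (u ≡ v → x ≡ 0ℚ) → ordered u v * x + ordered v u * x ≡ x
  ordered-complement u v x diagonal with toℕ u ℕ.<? toℕ v | toℕ v ℕ.<? toℕ u
  ... | yes u<v | yes v<u = ⊥-elim (ℕ.<-asym u<v v<u)
  ... | yes _   | no  _   = trans (cong₂ _+_ (*-identityˡ x) (*-zeroˡ x)) (+-identityʳ x)
  ... | no  _   | yes _   = trans (cong₂ _+_ (*-zeroˡ x) (*-identityˡ x)) (+-identityˡ x)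
  ... | no  u≮v | no  v≮u = trans (cong₂ _+_ (*-zeroˡ x) (*-zeroˡ x))
    (sym (diagonal (toℕ-injective (ℕ.≤-antisym (ℕ.≮⇒≥ v≮u) (ℕ.≮⇒≥ u≮v)))))

  doubleSum-+ : (f g : Fin n → Fin n → ℚ) →
    doubleSum (λ u v → f u v + g u v) ≡ doubleSum f + doubleSum g
  doubleSum-+ f g = trans (sumFin-cong (λ u → sumFin-+ (f u) (g u)))
    (sumFin-+ (λ u → sumFin (f u)) (λ u → sumFin (g u)))

  pairSum-doubled : (f : Fin n → Fin n → ℚ) → (∀ u v → f u v ≡ f v u) → (∀ u → f u u ≡ 0ℚ) →
    pairSum f + pairSum f ≡ doubleSum f
  pairSum-doubled f symmetric diagonal = begin
    pairSum f + pairSum f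
      ≡⟨ cong (pairSum f +_) (sumFin-comm (λ u v → ordered u v * f u v)) ⟩
    pairSum f + doubleSum (λ u v → ordered v u * f v u)
      ≡⟨ cong (pairSum f +_) (sumFin-cong (λ u → sumFin-cong (λ v →
           cong (ordered v u *_) (symmetric v u)))) ⟩
    pairSum f + doubleSum (λ u v → ordered v u * f u v)
      ≡⟨ sym (doubleSum-+ (λ u v → ordered u v * f u v) (λ u v → ordered v u * f u v)) ⟩
    doubleSum (λ u v → ordered u v * f u v + ordered v u * f u v)
      ≡⟨ sumFin-cong (λ u → sumFin-cong (λ v →
           ordered-complement u v (f u v) (λ { refl → diagonal u }))) ⟩
    doubleSum f ∎
    where open ≡-Reasoning

  doubleSum-*ˡ : (c : ℚ) (f : Fin n → Fin n → ℚ) → c * doubleSum f ≡ doubleSum (λ u v → c * f u v)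
  doubleSum-*ˡ c f = trans (sumFin-*ˡ c (λ u → sumFin (f u))) (sumFin-cong (λ u → sumFin-*ˡ c (f u)))

  -- Rational arithmetic

  *-monoʳ-≤-≥0 : ∀ {r p q} → 0ℚ ≤ r → p ≤ q → p * r ≤ q * r
  *-monoʳ-≤-≥0 {r} 0≤r = *-monoʳ-≤-nonNeg r {{nonNegative 0≤r}}

  *-monoˡ-≤-≥0 : ∀ {r p q} → 0ℚ ≤ r → p ≤ q → r * p ≤ r * q
  *-monoˡ-≤-≥0 {r} 0≤r = *-monoˡ-≤-nonNeg r {{nonNegative 0≤r}}

  *-≥0 : ∀ {p q} → 0ℚ ≤ p → 0ℚ ≤ q → 0ℚ ≤ p * q
  *-≥0 {p} {q} 0≤p 0≤q = ≤-trans (≤-reflexive (sym (*-zeroˡ q))) (*-monoʳ-≤-≥0 0≤q 0≤p)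

  ≤ᵇ-true⇒≤ : ∀ {p q} → (p ≤ᵇ q) ≡ true → p ≤ q
  ≤ᵇ-true⇒≤ p≤ᵇq = ≤ᵇ⇒≤ (subst Bool.T (sym p≤ᵇq) tt)

  ≤ᵇ-false⇒> : ∀ {p q} → (p ≤ᵇ q) ≡ false → q < p
  ≤ᵇ-false⇒> p≰ᵇq = ≰⇒> (λ p≤q → subst Bool.T p≰ᵇq (≤⇒≤ᵇ p≤q))

  half+half : ∀ x → ½ * x + ½ * x ≡ x
  half+half = solve 1 (λ x → con ½ :* x :+ con ½ :* x := x) refl
    where open +-*-Solver

  double-cancel-≤ : ∀ {x y} → x + x ≤ y + y → x ≤ y
  double-cancel-≤ {x} {y} x+x≤y+y = ≮⇒≥ (λ y<x → <-irrefl refl (<-≤-trans (+-mono-< y<x y<x) x+x≤y+y))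

  ℕ→ℚ≡mkℚ : ∀ k → ℕ→ℚ k ≡ mkℚ (ℤ.+ k) 0 (Coprime.sym (1-coprimeTo k))
  ℕ→ℚ≡mkℚ k = normalize-coprime (Coprime.sym (1-coprimeTo k))

  ℕ→ℚ-mono-≤ : ∀ {a b} → a ℕ.≤ b → ℕ→ℚ a ≤ ℕ→ℚ b
  ℕ→ℚ-mono-≤ {a} {b} a≤b rewrite ℕ→ℚ≡mkℚ a | ℕ→ℚ≡mkℚ b = *≤* (ℤ.*-monoʳ-≤-nonNeg (ℤ.+ 1) (ℤ.+≤+ a≤b))

  ℕ→ℚ-≥0 : ∀ k → 0ℚ ≤ ℕ→ℚ k
  ℕ→ℚ-≥0 k = ℕ→ℚ-mono-≤ (ℕ.z≤n {k})

  ℕ→ℚ-homo-* : ∀ a b → ℕ→ℚ (a ℕ.* b) ≡ ℕ→ℚ a * ℕ→ℚ b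
  ℕ→ℚ-homo-* a b = toℚᵘ-injective (ℚᵘ.≃-trans ℕ→ℚᵘ-homo (ℚᵘ.≃-sym (toℚᵘ-homo-* (ℕ→ℚ a) (ℕ→ℚ b))))
    where
    ℕ→ℚᵘ-homo : toℚᵘ (ℕ→ℚ (a ℕ.* b)) ℚᵘ.≃ toℚᵘ (ℕ→ℚ a) ℚᵘ.* toℚᵘ (ℕ→ℚ b)
    ℕ→ℚᵘ-homo rewrite ℕ→ℚ≡mkℚ (a ℕ.* b) | ℕ→ℚ≡mkℚ a | ℕ→ℚ≡mkℚ b =
      ℚᵘ.*≡* (cong (ℤ._* ℤ.1ℤ) (ℤ.pos-* a b))

  ind-≥0 : ∀ b → 0ℚ ≤ ind b
  ind-≥0 true  = *≤* (ℤ.+≤+ ℕ.z≤n)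
  ind-≥0 false = ≤-refl

  ind-*-≤ : ∀ b {x} → 0ℚ ≤ x → ind b * x ≤ x
  ind-*-≤ true  {x} _   = ≤-reflexive (*-identityˡ x)
  ind-*-≤ false {x} 0≤x = ≤-trans (≤-reflexive (*-zeroˡ x)) 0≤x

  ind-*-monoʳ-≤ : ∀ b {x y} → (b ≡ true → x ≤ y) → ind b * x ≤ ind b * y
  ind-*-monoʳ-≤ true  {x} {y} x≤y = *-monoˡ-≤-≥0 (ind-≥0 true) (x≤y refl)
  ind-*-monoʳ-≤ false {x} {y} _   = ≤-reflexive (trans (*-zeroˡ x) (sym (*-zeroˡ y)))

  ind-∧ : ∀ a b x → ind (a ∧ b) * x ≡ ind a * (ind b * x)
  ind-∧ true  b x = sym (*-identityˡ (ind b * x))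
  ind-∧ false b x = trans (*-zeroˡ x) (sym (*-zeroˡ (ind b * x)))

  ind-∨ : ∀ a b → (a ≡ true → b ≡ false) → ind (a ∨ b) ≡ ind a + ind b
  ind-∨ true  true  disjoint with () ← disjoint refl
  ind-∨ true  false _ = refl
  ind-∨ false b     _ = sym (+-identityˡ (ind b))

  -- vol G is definitionally mass (deg G).
  mass : (Fin n → ℚ) → Subset n → ℚ
  mass F S = sumFin (λ u → ind (S u) * F u)

  mass-∅ : (F : Fin n → ℚ) → mass F (λ _ → false) ≡ 0ℚ
  mass-∅ {zero}  F = refl
  mass-∅ {suc n} F = cong₂ _+_ (*-zeroˡ (F zero)) (mass-∅ (F ∘ suc))

  mass-all : (F : Fin n → ℚ) {S : Subset n} → (∀ u → S u ≡ true) → mass F S ≡ sumFin F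
  mass-all F all = sumFin-cong (λ u → trans (cong (λ b → ind b * F u) (all u)) (*-identityˡ (F u)))

  mass-≤-sumFin : {F : Fin n → ℚ} (S : Subset n) → (∀ u → 0ℚ ≤ F u) → mass F S ≤ sumFin F
  mass-≤-sumFin S F≥0 = sumFin-mono-≤ (λ u → ind-*-≤ (S u) (F≥0 u))

  mass-scale-≤ : ∀ {F F′ : Fin n → ℚ} {S} c → (∀ u → S u ≡ true → c * F u ≤ F′ u) →
    c * mass F S ≤ mass F′ S
  mass-scale-≤ {F = F} {S = S} c bound = begin
    c * mass F S                          ≡⟨ sumFin-*ˡ c (λ u → ind (S u) * F u) ⟩
    sumFin (λ u → c * (ind (S u) * F u))  ≡⟨ sumFin-cong (λ u → x∙yz≈y∙xz c (ind (S u)) (F u)) ⟩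
    sumFin (λ u → ind (S u) * (c * F u))  ≤⟨ sumFin-mono-≤ (λ u → ind-*-monoʳ-≤ (S u) (bound u)) ⟩
    mass _ S                              ∎
    where open ≤-Reasoning

  -- Trees

  size : Tree n → ℕ
  size T = length (leaves T)

  data _⊑_ {n} (N : Tree n) : Tree n → Set where
    ⊑-refl  : N ⊑ N
    ⊑-left  : ∀ {l r} → N ⊑ l → N ⊑ node l r
    ⊑-right : ∀ {l r} → N ⊑ r → N ⊑ node l r

  DistinctLeaves : Tree n → Set
  DistinctLeaves (leaf _)   = ⊤
  DistinctLeaves (node l r) =
    DistinctLeaves l × DistinctLeaves r × (∀ u → nodeSet l u ≡ true → nodeSet r u ≡ false)

  elem-++ : ∀ (u : Fin n) xs ys → elem u (xs ++ ys) ≡ elem u xs ∨ elem u ys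
  elem-++ u []       ys = refl
  elem-++ u (x ∷ xs) ys = trans (cong (⌊ u ≟ x ⌋ ∨_) (elem-++ u xs ys)) (sym (∨-assoc ⌊ u ≟ x ⌋ _ _))

  elem⇒∈ : ∀ {u : Fin n} xs → elem u xs ≡ true → u ∈ xs
  elem⇒∈ {u = u} (x ∷ xs) e with u ≟ x
  ... | yes u≡x = here u≡x
  ... | no  _   = there (elem⇒∈ xs e)

  ∈⇒elem : ∀ {u : Fin n} {xs} → u ∈ xs → elem u xs ≡ true
  ∈⇒elem {u = u} {x ∷ xs} u∈ with u ≟ x | u∈
  ... | yes _   | _          = refl
  ... | no  u≢x | here u≡x   = ⊥-elim (u≢x u≡x)
  ... | no  _   | there u∈xs = ∈⇒elem u∈xs

  private variable
    u v : Fin n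
    l r N T : Tree n

  nodeSet-node : ∀ l r (u : Fin n) → nodeSet (node l r) u ≡ nodeSet l u ∨ nodeSet r u
  nodeSet-node l r u = elem-++ u (leaves l) (leaves r)

  nodeSet-⊑ : N ⊑ T → nodeSet N u ≡ true → nodeSet T u ≡ true
  nodeSet-⊑ ⊑-refl                    u∈N = u∈N
  nodeSet-⊑ {u = u} (⊑-left  {l} {r} s) u∈N
    rewrite nodeSet-node l r u | nodeSet-⊑ s u∈N = refl
  nodeSet-⊑ {u = u} (⊑-right {l} {r} s) u∈N
    rewrite nodeSet-node l r u | nodeSet-⊑ s u∈N | ∨-zeroʳ (nodeSet l u) = refl

  size-node : ∀ (l r : Tree n) → size (node l r) ≡ size l ℕ.+ size r
  size-node l r = length-++ (leaves l)

  size-left : ∀ (l r : Tree n) → size l ℕ.≤ size (node l r)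
  size-left l r = ℕ.≤-trans (ℕ.m≤m+n (size l) (size r)) (ℕ.≤-reflexive (sym (size-node l r)))

  size-right : ∀ (l r : Tree n) → size r ℕ.≤ size (node l r)
  size-right l r = ℕ.≤-trans (ℕ.m≤n+m (size r) (size l)) (ℕ.≤-reflexive (sym (size-node l r)))

  size-⊑ : N ⊑ T → size N ℕ.≤ size T
  size-⊑ ⊑-refl              = ℕ.≤-refl
  size-⊑ (⊑-left  {l} {r} s) = ℕ.≤-trans (size-⊑ s) (size-left l r)
  size-⊑ (⊑-right {l} {r} s) = ℕ.≤-trans (size-⊑ s) (size-right l r)

  leaf-⊑ : (T : Tree n) → ∃[ v ] leaf v ⊑ T
  leaf-⊑ (leaf v)   = v , ⊑-refl
  leaf-⊑ (node l r) with leaf-⊑ l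
  ... | v , s = v , ⊑-left s

  nodeSet-nonempty : (T : Tree n) → ∃[ v ] nodeSet T v ≡ true
  nodeSet-nonempty T with leaf-⊑ T
  ... | v , s = v , nodeSet-⊑ s (∈⇒elem {xs = v ∷ []} (here refl))

  size≥1 : (T : Tree n) → 1 ℕ.≤ size T
  size≥1 T = size-⊑ (proj₂ (leaf-⊑ T))

  Unique-++⁻ : ∀ {A : Set} (xs : List A) {ys} → Unique (xs ++ ys) →
    Unique xs × Unique ys × (∀ {x} → x ∈ xs → x ∉ ys)
  Unique-++⁻ []       ys! = [] , ys! , λ ()
  Unique-++⁻ (x ∷ xs) (x∉ ∷ xs++ys!) with Unique-++⁻ xs xs++ys!
  ... | xs! , ys! , disjoint =
    All.++⁻ˡ xs x∉ ∷ xs! , ys! ,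
    λ { (here refl) y∈ys → All.lookup (All.++⁻ʳ xs x∉) y∈ys refl
      ; (there x∈xs)     → disjoint x∈xs }

  Unique⇒DistinctLeaves : (T : Tree n) → Unique (leaves T) → DistinctLeaves T
  Unique⇒DistinctLeaves (leaf _)   _ = tt
  Unique⇒DistinctLeaves (node l r) T! with Unique-++⁻ (leaves l) T!
  ... | l! , r! , disjoint =
    Unique⇒DistinctLeaves l l! , Unique⇒DistinctLeaves r r! , separate
    where
    separate : ∀ u → nodeSet l u ≡ true → nodeSet r u ≡ false
    separate u u∈l with nodeSet r u in u∈r
    ... | false = refl
    ... | true  = ⊥-elim (disjoint (elem⇒∈ (leaves l) u∈l) (elem⇒∈ (leaves r) u∈r))

  DistinctLeaves-⊑ : N ⊑ T → DistinctLeaves T → DistinctLeaves N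
  DistinctLeaves-⊑ ⊑-refl      d           = d
  DistinctLeaves-⊑ (⊑-left  s) (dl , _ , _) = DistinctLeaves-⊑ s dl
  DistinctLeaves-⊑ (⊑-right s) (_ , dr , _) = DistinctLeaves-⊑ s dr

  module _ (T : Tree n) (hc : IsHC T) where

    IsHC⇒DistinctLeaves : DistinctLeaves T
    IsHC⇒DistinctLeaves = Unique⇒DistinctLeaves T
      (Permₛ.Unique-resp-↭ (≡.setoid (Fin n)) (↭⇒↭ₛ (↭-sym hc)) (allFin⁺ n))

    IsHC⇒nodeSet-full : ∀ u → nodeSet T u ≡ true
    IsHC⇒nodeSet-full u = ∈⇒elem (∈-resp-↭ (↭-sym hc) (∈-allFin u))

    IsHC⇒size : size T ≡ n
    IsHC⇒size = trans (↭-length hc) (length-tabulate (λ i → i))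

  lcaSize-sym : ∀ (T : Tree n) u v → lcaSize T u v ≡ lcaSize T v u
  lcaSize-sym (leaf _)   u v = refl
  lcaSize-sym (node l r) u v
    rewrite ∧-comm (nodeSet l u) (nodeSet l v) | ∧-comm (nodeSet r u) (nodeSet r v)
          | lcaSize-sym l u v | lcaSize-sym r u v = refl

  lcaSize≤size : ∀ (T : Tree n) u v → lcaSize T u v ℕ.≤ size T
  lcaSize≤size (leaf _)   u v = ℕ.≤-refl
  lcaSize≤size (node l r) u v with nodeSet l u ∧ nodeSet l v | nodeSet r u ∧ nodeSet r v
  ... | true  | _     = ℕ.≤-trans (lcaSize≤size l u v) (size-left l r)
  ... | false | true  = ℕ.≤-trans (lcaSize≤size r u v) (size-right l r)
  ... | false | false = ℕ.≤-refl

  lcaSize-monoˡ : ∀ {l r : Tree n} {u} v → DistinctLeaves (node l r) → nodeSet l u ≡ true →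
    lcaSize l u v ℕ.≤ lcaSize (node l r) u v
  lcaSize-monoˡ {l = l} {r} {u} v (_ , _ , disjoint) u∈l
    rewrite u∈l | disjoint u u∈l with nodeSet l v
  ... | true  = ℕ.≤-refl
  ... | false = ℕ.≤-trans (lcaSize≤size l u v) (size-left l r)

  lcaSize-monoʳ : ∀ {l r : Tree n} {u} v → DistinctLeaves (node l r) → nodeSet r u ≡ true →
    lcaSize r u v ℕ.≤ lcaSize (node l r) u v
  lcaSize-monoʳ {l = l} {r} {u} v (_ , _ , disjoint) u∈r with nodeSet l u in u∈l
  ... | true with () ← trans (sym u∈r) (disjoint u u∈l)
  ... | false rewrite u∈r with nodeSet r v
  ...   | true  = ℕ.≤-refl
  ...   | false = ℕ.≤-trans (lcaSize≤size r u v) (size-right l r)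

  lcaSize-mono-⊑ : ∀ v → N ⊑ T → DistinctLeaves T → nodeSet N u ≡ true →
    lcaSize N u v ℕ.≤ lcaSize T u v
  lcaSize-mono-⊑ v ⊑-refl      _ _   = ℕ.≤-refl
  lcaSize-mono-⊑ v (⊑-left  s) d u∈N =
    ℕ.≤-trans (lcaSize-mono-⊑ v s (proj₁ d) u∈N) (lcaSize-monoˡ v d (nodeSet-⊑ s u∈N))
  lcaSize-mono-⊑ v (⊑-right s) d u∈N =
    ℕ.≤-trans (lcaSize-mono-⊑ v s (proj₁ (proj₂ d)) u∈N) (lcaSize-monoʳ v d (nodeSet-⊑ s u∈N))

  Separates : Subset n → Fin n → Fin n → Set
  Separates S u v = S u ≡ true × S v ≡ false

  SplitBy : Tree n → Tree n → Fin n → Fin n → Set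
  SplitBy l r u v = Separates (nodeSet l) u v ⊎ Separates (nodeSet r) u v

  lcaSize-split : DistinctLeaves (node l r) → SplitBy l r u v → lcaSize (node l r) u v ≡ size (node l r)
  lcaSize-split {u = u} (_ , _ , disjoint) (inj₁ (u∈l , v∉l)) rewrite u∈l | v∉l | disjoint u u∈l = refl
  lcaSize-split {l = l} {u = u} (_ , _ , disjoint) (inj₂ (u∈r , v∉r)) with nodeSet l u in u∈l
  ... | true with () ← trans (sym u∈r) (disjoint u u∈l)
  ... | false rewrite u∈r | v∉r = refl

  size≤lcaSize-split : node l r ⊑ T → DistinctLeaves T → SplitBy l r u v →
    size (node l r) ℕ.≤ lcaSize T u v
  size≤lcaSize-split {l = l} {r} {T} {u} {v} s d split = begin
    size (node l r)          ≡⟨ sym (lcaSize-split (DistinctLeaves-⊑ s d) split) ⟩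
    lcaSize (node l r) u v   ≤⟨ lcaSize-mono-⊑ v s d (split⇒∈ split) ⟩
    lcaSize T u v            ∎
    where
    open ℕ.≤-Reasoning
    split⇒∈ : SplitBy l r u v → nodeSet (node l r) u ≡ true
    split⇒∈ (inj₁ (u∈l , _)) = nodeSet-⊑ {T = node l r} (⊑-left ⊑-refl) u∈l
    split⇒∈ (inj₂ (u∈r , _)) = nodeSet-⊑ {T = node l r} (⊑-right ⊑-refl) u∈r

  splitPoint : List (Fin n) → ℕ
  splitPoint xs = 2 ℕ.^ ⌊log₂ (length xs ℕ.∸ 1) ⌋

  buildDeg-leaves : ∀ fuel (xs : List (Fin n)) {T} → buildDeg fuel xs ≡ just T → leaves T ≡ xs
  buildDeg-leaves fuel       (v ∷ [])         refl = refl
  buildDeg-leaves (suc fuel) xs@(_ ∷ _ ∷ _) {T} built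
    with buildDeg fuel (take (splitPoint xs) xs) in left | buildDeg fuel (drop (splitPoint xs) xs) in right
  ... | just a | just b with refl ← built =
    trans (cong₂ _++_ (buildDeg-leaves fuel (take (splitPoint xs) xs) left)
                      (buildDeg-leaves fuel (drop (splitPoint xs) xs) right))
          (take++drop≡id (splitPoint xs) xs)

  insertDeg-length : ∀ (G : WGraph n) v xs → length (insertDeg G v xs) ≡ suc (length xs)
  insertDeg-length G v []       = refl
  insertDeg-length G v (x ∷ xs) with deg G x ≤ᵇ deg G v
  ... | true  = refl
  ... | false = cong suc (insertDeg-length G v xs)

  sortDeg-length : ∀ (G : WGraph n) xs → length (sortDeg G xs) ≡ length xs
  sortDeg-length G []       = refl
  sortDeg-length G (x ∷ xs) = trans (insertDeg-length G x (sortDeg G xs)) (cong suc (sortDeg-length G xs))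

  Tdeg-size : ∀ (G : WGraph n) {T} → Tdeg G ≡ just T → size T ≡ n
  Tdeg-size {n} G {T} built = begin
    size T                         ≡⟨ cong length (buildDeg-leaves n (sortDeg G (allFin n)) built) ⟩
    length (sortDeg G (allFin n))  ≡⟨ sortDeg-length G (allFin n) ⟩
    length (allFin n)              ≡⟨ length-tabulate (λ i → i) ⟩
    n                              ∎
    where open ≡-Reasoning

  mass-node : ∀ (F : Fin n → ℚ) {l r} → DistinctLeaves (node l r) →
    mass F (nodeSet (node l r)) ≡ mass F (nodeSet l) + mass F (nodeSet r)
  mass-node F {l} {r} (_ , _ , disjoint) = trans (sumFin-cong split)
    (sumFin-+ (λ u → ind (nodeSet l u) * F u) (λ u → ind (nodeSet r u) * F u))
    where
    split : ∀ u → ind (nodeSet (node l r) u) * F u ≡ ind (nodeSet l u) * F u + ind (nodeSet r u) * F u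
    split u = trans (cong (λ b → ind b * F u) (nodeSet-node l r u))
      (trans (cong (_* F u) (ind-∨ (nodeSet l u) (nodeSet r u) (disjoint u)))
        (*-distribʳ-+ (F u) (ind (nodeSet l u)) (ind (nodeSet r u))))

  mass-leaf : (F : Fin n → ℚ) (v : Fin n) → mass F (nodeSet (leaf v)) ≡ F v
  mass-leaf F zero    = trans (cong₂ _+_ (*-identityˡ (F zero)) (mass-∅ (F ∘ suc))) (+-identityʳ (F zero))
  mass-leaf F (suc v) = trans (cong₂ _+_ (*-zeroˡ (F zero)) shift) (+-identityˡ (F (suc v)))
    where
    -- ⌊ suc i ≟ suc v ⌋ is not definitionally ⌊ i ≟ v ⌋: ⌊_⌋ matches on the Dec constructor.
    nodeSet-leaf-suc : ∀ i → nodeSet (leaf (suc v)) (suc i) ≡ nodeSet (leaf v) i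
    nodeSet-leaf-suc i with i ≟ v
    ... | yes _ = refl
    ... | no  _ = refl
    shift : mass (F ∘ suc) (nodeSet (leaf (suc v)) ∘ suc) ≡ F (suc v)
    shift = trans (sumFin-cong (λ i → cong (λ b → ind b * F (suc i)) (nodeSet-leaf-suc i)))
      (mass-leaf (F ∘ suc) v)

  -- Volumes, cuts and costs

  module _ (G : WGraph n) where

    Heavy Light : Tree n → Set
    Heavy T = ½ * volG G < vol G (nodeSet T)
    Light T = vol G (nodeSet T) ≤ ½ * volG G

    lcaWeight : Tree n → Fin n → Fin n → ℚ
    lcaWeight T u v = w G u v * ℕ→ℚ (lcaSize T u v)

    lcaWeight-≥0 : ∀ T u v → 0ℚ ≤ lcaWeight T u v
    lcaWeight-≥0 T u v = *-≥0 (w-nonneg G u v) (ℕ→ℚ-≥0 (lcaSize T u v))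

    -- cost G T is definitionally pairSum (lcaWeight T).
    cost-doubled : ∀ T → cost G T + cost G T ≡ doubleSum (lcaWeight T)
    cost-doubled T = pairSum-doubled (lcaWeight T)
      (λ u v → cong₂ (λ x k → x * ℕ→ℚ k) (w-sym G u v) (lcaSize-sym T u v))
      (λ u → trans (cong (_* ℕ→ℚ (lcaSize T u u)) (w-loop G u)) (*-zeroˡ (ℕ→ℚ (lcaSize T u u))))

    volG≡doubleSum : volG G ≡ doubleSum (w G)
    volG≡doubleSum = mass-all (deg G) (λ _ → refl)

    cost-upper : ∀ T → cost G T + cost G T ≤ ℕ→ℚ (size T) * volG G
    cost-upper T = begin
      cost G T + cost G T                     ≡⟨ cost-doubled T ⟩
      doubleSum (lcaWeight T)                 ≤⟨ sumFin-mono-≤ (λ u → sumFin-mono-≤ (λ v → weight≤ u v)) ⟩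
      doubleSum (λ u v → |T| * w G u v)       ≡⟨ sym (doubleSum-*ˡ |T| (w G)) ⟩
      |T| * doubleSum (w G)                   ≡⟨ cong (|T| *_) (sym volG≡doubleSum) ⟩
      |T| * volG G                            ∎
      where
      open ≤-Reasoning
      |T| = ℕ→ℚ (size T)
      weight≤ : ∀ u v → lcaWeight T u v ≤ |T| * w G u v
      weight≤ u v = ≤-trans (*-monoˡ-≤-≥0 (w-nonneg G u v) (ℕ→ℚ-mono-≤ (lcaSize≤size T u v)))
        (≤-reflexive (*-comm (w G u v) |T|))

    outWeight : Subset n → Fin n → ℚ
    outWeight S u = sumFin (λ v → ind (not (S v)) * w G u v)

    cut≡mass-outWeight : ∀ S → cut G S ≡ mass (outWeight S) S
    cut≡mass-outWeight S = sumFin-cong λ u → begin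
      sumFin (λ v → ind (S u ∧ not (S v)) * w G u v)    ≡⟨ sumFin-cong (λ v → ind-∧ (S u) (not (S v)) (w G u v)) ⟩
      sumFin (λ v → ind (S u) * (ind (not (S v)) * w G u v))
        ≡⟨ sym (sumFin-*ˡ (ind (S u)) (λ v → ind (not (S v)) * w G u v)) ⟩
      ind (S u) * outWeight S u                          ∎
      where open ≡-Reasoning

    cut-scale-≤ : ∀ S c (L : Fin n → Fin n → ℚ) → (∀ u v → 0ℚ ≤ L u v) →
      (∀ u v → Separates S u v → c ≤ L u v) →
      c * cut G S ≤ mass (λ u → sumFin (λ v → w G u v * L u v)) S
    cut-scale-≤ S c L L≥0 c≤L = begin
      c * cut G S                    ≡⟨ cong (c *_) (cut≡mass-outWeight S) ⟩
      c * mass (outWeight S) S       ≤⟨ mass-scale-≤ c outWeight≤ ⟩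
      mass (λ u → sumFin (λ v → w G u v * L u v)) S ∎
      where
      open ≤-Reasoning
      term≤ : ∀ u v → S u ≡ true → c * (ind (not (S v)) * w G u v) ≤ w G u v * L u v
      term≤ u v u∈S = begin
        c * (ind (not (S v)) * w G u v)   ≡⟨ x∙yz≈y∙xz c (ind (not (S v))) (w G u v) ⟩
        ind (not (S v)) * (c * w G u v)   ≤⟨ ind-*-monoʳ-≤ (not (S v)) c·w≤ ⟩
        ind (not (S v)) * (w G u v * L u v)
          ≤⟨ ind-*-≤ (not (S v)) (*-≥0 (w-nonneg G u v) (L≥0 u v)) ⟩
        w G u v * L u v                   ∎
        where
        c·w≤ : not (S v) ≡ true → c * w G u v ≤ w G u v * L u v
        c·w≤ v∉S with S v in v∈S
        ... | false = ≤-trans (*-monoʳ-≤-≥0 (w-nonneg G u v) (c≤L u v (u∈S , v∈S)))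
                        (≤-reflexive (*-comm (L u v) (w G u v)))
      outWeight≤ : ∀ u → S u ≡ true → c * outWeight S u ≤ sumFin (λ v → w G u v * L u v)
      outWeight≤ u u∈S = begin
        c * outWeight S u     ≡⟨ sumFin-*ˡ c (λ v → ind (not (S v)) * w G u v) ⟩
        sumFin (λ v → c * (ind (not (S v)) * w G u v)) ≤⟨ sumFin-mono-≤ (λ v → term≤ u v u∈S) ⟩
        sumFin (λ v → w G u v * L u v) ∎

    w≤deg : ∀ u v → w G u v ≤ deg G u
    w≤deg u v = begin
      w G u v                        ≡⟨ sym (mass-leaf (w G u) v) ⟩
      mass (w G u) (nodeSet (leaf v)) ≤⟨ mass-≤-sumFin (nodeSet (leaf v)) (w-nonneg G u) ⟩
      deg G u                        ∎
      where open ≤-Reasoning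

    deg-doubled-≤ : ∀ v → deg G v + deg G v ≤ volG G
    deg-doubled-≤ v = begin
      deg G v + deg G v                                    ≡⟨ cong₂ _+_ (sym (mass-leaf (deg G) v)) in-degree ⟩
      mass (deg G) (nodeSet (leaf v)) + sumFin (λ u → w G u v)
        ≡⟨ sym (sumFin-+ (λ u → ind (nodeSet (leaf v) u) * deg G u) (λ u → w G u v)) ⟩
      sumFin (λ u → ind (nodeSet (leaf v) u) * deg G u + w G u v) ≤⟨ sumFin-mono-≤ term≤ ⟩
      sumFin (deg G)                                        ≡⟨ sym (mass-all (deg G) (λ _ → refl)) ⟩
      volG G                                                ∎
      where
      open ≤-Reasoning
      in-degree : deg G v ≡ sumFin (λ u → w G u v)
      in-degree = sumFin-cong (w-sym G v)
      term≤ : ∀ u → ind (nodeSet (leaf v) u) * deg G u + w G u v ≤ deg G u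
      term≤ u with u ≟ v
      ... | yes refl = ≤-reflexive (trans (cong₂ _+_ (*-identityˡ (deg G u)) (w-loop G u)) (+-identityʳ (deg G u)))
      ... | no  _    = ≤-trans (≤-reflexive (trans (cong (_+ w G u v) (*-zeroˡ (deg G u))) (+-identityˡ (w G u v))))
                         (w≤deg u v)

    leaf-light : ∀ v → ¬ Heavy (leaf v)
    leaf-light v heavy = <-irrefl refl (begin-strict
      volG G                    ≡⟨ sym (half+half (volG G)) ⟩
      ½ * volG G + ½ * volG G   <⟨ +-mono-< heavy′ heavy′ ⟩
      deg G v + deg G v         ≤⟨ deg-doubled-≤ v ⟩
      volG G                    ∎)
      where
      open ≤-Reasoning
      heavy′ : ½ * volG G < deg G v
      heavy′ = <-≤-trans heavy (≤-reflexive (mass-leaf (deg G) v))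

    heavy-root : ∀ φ T → IsConductance G φ → IsHC T → Heavy T
    heavy-root φ T (vol>0 , _ , S , admissible , _) hc = begin-strict
      ½ * volG G                ≡⟨ sym (+-identityʳ (½ * volG G)) ⟩
      ½ * volG G + 0ℚ           <⟨ +-monoʳ-< (½ * volG G) (<-≤-trans (vol>0 S admissible) (proj₂ admissible)) ⟩
      ½ * volG G + ½ * volG G   ≡⟨ half+half (volG G) ⟩
      volG G                    ≡⟨ mass-all (deg G) (λ _ → refl) ⟩
      sumFin (deg G)            ≡⟨ sym (mass-all (deg G) (IsHC⇒nodeSet-full T hc)) ⟩
      vol G (nodeSet T)         ∎
      where open ≤-Reasoning

    record DenseEnd (T E : Tree n) : Set where
      field
        childˡ childʳ : Tree n
        shape         : E ≡ node childˡ childʳ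
        subtree       : node childˡ childʳ ⊑ T
        childˡ-light  : Light childˡ
        childʳ-light  : Light childʳ
        heavy         : Heavy (node childˡ childʳ)

    DenseEnd-left : ∀ {l E} r → DenseEnd l E → DenseEnd (node l r) E
    DenseEnd-left r d = record { DenseEnd d hiding (subtree) ; subtree = ⊑-left (DenseEnd.subtree d) }

    DenseEnd-right : ∀ l {r E} → DenseEnd r E → DenseEnd (node l r) E
    DenseEnd-right l d = record { DenseEnd d hiding (subtree) ; subtree = ⊑-right (DenseEnd.subtree d) }

    denseEnd-spec : ∀ T → Heavy T → DenseEnd T (denseEnd G T)
    denseEnd-descend : ∀ l r → Heavy l ⊎ Heavy r →
      DenseEnd (node l r)
        (if vol G (nodeSet r) ≤ᵇ vol G (nodeSet l) then denseEnd G l else denseEnd G r)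

    denseEnd-spec (leaf v)   heavy = ⊥-elim (leaf-light v heavy)
    denseEnd-spec (node l r) heavy
      with vol G (nodeSet l) ≤ᵇ ½ * volG G in l-light | vol G (nodeSet r) ≤ᵇ ½ * volG G in r-light
    ... | true  | true  = record
      { shape = refl ; subtree = ⊑-refl ; heavy = heavy
      ; childˡ-light = ≤ᵇ-true⇒≤ l-light ; childʳ-light = ≤ᵇ-true⇒≤ r-light }
    ... | true  | false = denseEnd-descend l r (inj₂ (≤ᵇ-false⇒> r-light))
    ... | false | _     = denseEnd-descend l r (inj₁ (≤ᵇ-false⇒> l-light))

    denseEnd-descend l r heavy-child with vol G (nodeSet r) ≤ᵇ vol G (nodeSet l) in r≤l
    ... | true  = DenseEnd-left r (denseEnd-spec l (heavy-left heavy-child))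
      where
      heavy-left : Heavy l ⊎ Heavy r → Heavy l
      heavy-left (inj₁ h<l) = h<l
      heavy-left (inj₂ h<r) = <-≤-trans h<r (≤ᵇ-true⇒≤ r≤l)
    ... | false = DenseEnd-right l (denseEnd-spec r (heavy-right heavy-child))
      where
      heavy-right : Heavy l ⊎ Heavy r → Heavy r
      heavy-right (inj₁ h<l) = <-trans h<l (≤ᵇ-false⇒> r≤l)
      heavy-right (inj₂ h<r) = h<r

    conductance-split : ∀ φ {l r} → IsConductance G φ → DistinctLeaves (node l r) →
      Light l → Light r → φ * vol G (nodeSet (node l r)) ≤ cut G (nodeSet l) + cut G (nodeSet r)
    conductance-split φ {l} {r} (_ , φ-minimal , _) distinct l-light r-light = begin
      φ * vol G (nodeSet (node l r))                     ≡⟨ cong (φ *_) (mass-node (deg G) distinct) ⟩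
      φ * (vol G (nodeSet l) + vol G (nodeSet r))        ≡⟨ *-distribˡ-+ φ _ _ ⟩
      φ * vol G (nodeSet l) + φ * vol G (nodeSet r)
        ≤⟨ +-mono-≤ (φ-minimal (nodeSet l) (nodeSet-nonempty l , l-light))
                    (φ-minimal (nodeSet r) (nodeSet-nonempty r , r-light)) ⟩
      cut G (nodeSet l) + cut G (nodeSet r)              ∎
      where open ≤-Reasoning

    cut-split-≤-cost : ∀ {l r T} → node l r ⊑ T → DistinctLeaves T →
      ℕ→ℚ (size (node l r)) * (cut G (nodeSet l) + cut G (nodeSet r)) ≤ cost G T + cost G T
    cut-split-≤-cost {l} {r} {T} sub distinct = begin
      a * (cut G (nodeSet l) + cut G (nodeSet r))      ≡⟨ *-distribˡ-+ a _ _ ⟩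
      a * cut G (nodeSet l) + a * cut G (nodeSet r)
        ≤⟨ +-mono-≤ (cut-scale-≤ (nodeSet l) a L L≥0 (λ u v sep → a≤L u v (inj₁ sep)))
                    (cut-scale-≤ (nodeSet r) a L L≥0 (λ u v sep → a≤L u v (inj₂ sep))) ⟩
      mass F (nodeSet l) + mass F (nodeSet r)          ≡⟨ sym (mass-node F (DistinctLeaves-⊑ sub distinct)) ⟩
      mass F (nodeSet (node l r))                      ≤⟨ mass-≤-sumFin (nodeSet (node l r)) F≥0 ⟩
      doubleSum (lcaWeight T)                        ≡⟨ sym (cost-doubled T) ⟩
      cost G T + cost G T                              ∎
      where
      open ≤-Reasoning
      a = ℕ→ℚ (size (node l r))
      L : Fin n → Fin n → ℚ
      L u v = ℕ→ℚ (lcaSize T u v)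
      L≥0 : ∀ u v → 0ℚ ≤ L u v
      L≥0 u v = ℕ→ℚ-≥0 (lcaSize T u v)
      a≤L : ∀ u v → SplitBy l r u v → a ≤ L u v
      a≤L u v split = ℕ→ℚ-mono-≤ (size≤lcaSize-split sub distinct split)
      F : Fin n → ℚ
      F u = sumFin (lcaWeight T u)
      F≥0 : ∀ u → 0ℚ ≤ F u
      F≥0 u = sumFin-nonNeg (lcaWeight-≥0 T u)

  1+2a≤4a : ∀ a → 1 ℕ.≤ a → 1 ℕ.+ 2 ℕ.* a ℕ.≤ 4 ℕ.* a
  1+2a≤4a a 1≤a = ℕ.≤-trans (ℕ.+-monoˡ-≤ (2 ℕ.* a) 1≤a) (ℕ.+-monoʳ-≤ a (ℕ.m≤n+m (2 ℕ.* a) a))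

  module _ (G : WGraph n) (φ : ℚ) (conductance : IsConductance G φ) (0≤φ : 0ℚ ≤ φ) where

    dense-cost-bound : ∀ T* {E} → IsHC T* → DenseEnd G T* E → n ℕ.≤ 1 ℕ.+ 2 ℕ.* size E →
      ∀ T → size T ≡ n → cost G T * φ ≤ ℕ→ℚ 8 * cost G T*
    dense-cost-bound T* hc* dense n≤1+2|E| T |T|≡n = double-cancel-≤ (begin
      cost G T * φ + cost G T * φ            ≡⟨ sym (*-distribʳ-+ φ (cost G T) (cost G T)) ⟩
      (cost G T + cost G T) * φ              ≤⟨ *-monoʳ-≤-≥0 0≤φ (cost-upper G T) ⟩
      (ℕ→ℚ (size T) * volG G) * φ            ≤⟨ *-monoʳ-≤-≥0 0≤φ (*-monoʳ-≤-≥0 volG≥0 |T|≤4a) ⟩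
      (ℕ→ℚ 4 * a * volG G) * φ               ≤⟨ *-monoʳ-≤-≥0 0≤φ (*-monoˡ-≤-≥0 4a≥0 volG≤2vA) ⟩
      (ℕ→ℚ 4 * a * (vA + vA)) * φ            ≡⟨ regroup ⟩
      ℕ→ℚ 8 * (a * (φ * vA))                 ≤⟨ *-monoˡ-≤-≥0 (ℕ→ℚ-≥0 8) (*-monoˡ-≤-≥0 (ℕ→ℚ-≥0 |A|)
                                                  (conductance-split G φ conductance distinctA childˡ-light childʳ-light)) ⟩
      ℕ→ℚ 8 * (a * (cut G (nodeSet childˡ) + cut G (nodeSet childʳ)))
                                             ≤⟨ *-monoˡ-≤-≥0 (ℕ→ℚ-≥0 8) (cut-split-≤-cost G subtree distinct*) ⟩
      ℕ→ℚ 8 * (cost G T* + cost G T*)        ≡⟨ *-distribˡ-+ (ℕ→ℚ 8) (cost G T*) (cost G T*) ⟩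
      ℕ→ℚ 8 * cost G T* + ℕ→ℚ 8 * cost G T* ∎)
      where
      open ≤-Reasoning
      open DenseEnd dense
      |A| = size (node childˡ childʳ)
      a   = ℕ→ℚ |A|
      vA  = vol G (nodeSet (node childˡ childʳ))
      distinct* = IsHC⇒DistinctLeaves T* hc*
      distinctA = DistinctLeaves-⊑ subtree distinct*
      volG≥0 : 0ℚ ≤ volG G
      volG≥0 = sumFin-nonNeg (λ u → *-≥0 (ind-≥0 true) (sumFin-nonNeg (w-nonneg G u)))
      4a≥0 : 0ℚ ≤ ℕ→ℚ 4 * a
      4a≥0 = *-≥0 (ℕ→ℚ-≥0 4) (ℕ→ℚ-≥0 |A|)
      |T|≤4a : ℕ→ℚ (size T) ≤ ℕ→ℚ 4 * a
      |T|≤4a = begin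
        ℕ→ℚ (size T)      ≡⟨ cong ℕ→ℚ |T|≡n ⟩
        ℕ→ℚ n             ≤⟨ ℕ→ℚ-mono-≤ (ℕ.≤-trans n≤1+2|A| (1+2a≤4a |A| (size≥1 (node childˡ childʳ)))) ⟩
        ℕ→ℚ (4 ℕ.* |A|)   ≡⟨ ℕ→ℚ-homo-* 4 |A| ⟩
        ℕ→ℚ 4 * a         ∎
        where n≤1+2|A| = subst (λ A → n ℕ.≤ 1 ℕ.+ 2 ℕ.* size A) shape n≤1+2|E|
      regroup : (ℕ→ℚ 4 * a * (vA + vA)) * φ ≡ ℕ→ℚ 8 * (a * (φ * vA))
      regroup = solve 3 (λ a vA φ → (con (ℕ→ℚ 4) :* a :* (vA :+ vA)) :* φ := con (ℕ→ℚ 8) :* (a :* (φ :* vA)))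
        refl a vA φ
        where open +-*-Solver
      volG≤2vA : volG G ≤ vA + vA
      volG≤2vA = ≤-trans (≤-reflexive (sym (half+half (volG G)))) (<⇒≤ (+-mono-< heavy heavy))

open import Defs
open import Data.Nat using (_≤_; _+_; _*_)
open import Data.Maybe using (just)
open import Data.List using (length)
open import Data.Product using (_×_; _,_)
open import Data.Integer using (+_)
open import Data.Rational using (ℚ; 0ℚ; _<_; _/_) renaming (_≤_ to _≤ℚ_; _*_ to _*ℚ_)
open import Data.Rational.Properties using (<⇒≤)
open import Relation.Binary.PropositionalEquality using (_≡_)
open CostBound using (size; IsHC⇒size; Tdeg-size; heavy-root; denseEnd-spec; dense-cost-bound)

lemma3p8 : ∀ {n} (G : WGraph n) (φ : ℚ) → IsConductance G φ → 0ℚ < φ →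
    (T* : Tree n) → IsOptimal G T* →
    n ≤ 1 + 2 * length (leaves (denseEnd G T*)) →
    (∀ (T : Tree n) → IsHC T → cost G T *ℚ φ ≤ℚ (+ 8 / 1) *ℚ cost G T*)
    × (∀ (T : Tree n) → Tdeg G ≡ just T → cost G T *ℚ φ ≤ℚ (+ 8 / 1) *ℚ cost G T*)
lemma3p8 {n} G φ conductance 0<φ T* (hc* , _) n≤1+2|A| =
  (λ T hc → bound T (IsHC⇒size T hc)) , (λ T built → bound T (Tdeg-size G built))
  where
  bound : ∀ T → size T ≡ n → cost G T *ℚ φ ≤ℚ (+ 8 / 1) *ℚ cost G T*
  bound = dense-cost-bound G φ conductance (<⇒≤ 0<φ) T* hc*
    (denseEnd-spec G T* (heavy-root G φ T* conductance hc*)) n≤1+2|A|
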